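{- Let $\mathcal{G}$ be a core-semiperiphery-periphery (CSP) structure with core vertex set $C$, semiperiphery vertex set $S$ and periphery vertex set $P$. Then $C$ is the disjoint union of two sets $C_0$ and $C_1$ (either of which may be empty, but $n_c=|C_0|+|C_1|>0$), such that, writing $\mathcal{C}_0,\mathcal{C}_1,\mathcal{C},\mathcal{S},\mathcal{P}$ for the subgraphs induced by $C_0,C_1,C,S,P$ and $n_0=|C_0|$, $n_1=|C_1|$, $n_s=|S|$, $n_p=|P|$: 1. $\mathcal{C}$ is the join $\mathcal{C}_0+\mathcal{C}_1$, where $\mathcal{C}_0$ is the complete graph $K_{n_0}$ and $\mathcal{C}_1$ is a graph of order $n_1$ with no two distinct true twin vertices (within $\mathcal{C}_1$); 2. the subgraph induced by $C\cup S$ is the join $\mathcal{C}+\mathcal{S}$, where $\mathcal{S}$ is a graph of order $n_s$ having no pair of distinct induced subgraphs that are F-twins in $\mathcal{S}$; 3. $\mathcal{P}$ is an empty (edgeless) graph of order $n_p=n_0+n_s$; every periphery vertex is a leaf, and periphery vertices are attached in a one-to-one manner to the vertices of $C_0\cup S$ (each vertex of $C_0\cup S$ is adjacent to exactly one periphery vertex, and each periphery vertex is adjacent to exactly one vertex, which lies in $C_0\cup S$). Moreover $n_c$, $n_s$, $n_p$ are all nonzero.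
   Context: All graphs are finite, undirected, without loops or parallel edges. $\mathcal{N}(u)$ is the set of neighbors of $u$ and $\mathcal{N}[u]=\mathcal{N}(u)\cup\{u\}$; distinct vertices $u,v$ are true twins if $\mathcal{N}[u]=\mathcal{N}[v]$. The eccentricity of a vertex in a connected graph is its maximum distance to other vertices; a leaf is a vertex of degree one. The join $A+B$ of disjoint graphs is their union together with all edges joining a vertex of $A$ to a vertex of $B$ ($K_0$ denotes the null graph). Two induced subgraphs $H_1,H_2$ (vertex sets $V_1,V_2$) of a graph are F-twins if there is an isomorphism $\varphi:V_1\to V_2$ with $\mathcal{N}(u)-V_1=\mathcal{N}(\varphi(u))-V_2$ for all $u\in V_1$; for partitioned graphs $\varphi$ is additionally required to preserve the partition classes. A core-semiperiphery-periphery (CSP) structure is a connected graph whose vertex set is partitioned into three nonempty classes: core vertices, each with eccentricity at most two; semiperiphery vertices, each adjacent to at least a pair of mutually non-adjacent vertices, one a core vertex and one a periphery vertex; and periphery vertices, each of degree one. Moreover, the graph has no two distinct core vertices that are true twins, and no two distinct induced subgraphs contained in the semiperiphery-periphery vertex set that are F-twins (via a class-preserving isomorphism). -}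

module Defs where

open import Data.Nat using (ℕ; zero; suc; _≤_; _>_; _+_)
open import Data.Fin using (Fin)
open import Data.Fin.Subset using (Subset; _∈_; _∉_; ∣_∣)
open import Data.Vec using (tabulate)
open import Data.Bool using (Bool; true; false)
open import Data.Product using (Σ; ∃; ∃-syntax; _×_; _,_; proj₁)
open import Data.Sum using (_⊎_)
open import Data.Unit using (⊤)
open import Relation.Nullary using (¬_; Dec)
open import Relation.Binary using (Decidable)
open import Relation.Binary.PropositionalEquality using (_≡_; _≢_)
open import Function.Bundles using (_⇔_; _⤖_; Bijection)

record Graph (n : ℕ) : Set₁ where
  field
    Adj    : Fin n → Fin n → Set
    adj?   : Decidable Adj
    sym    : ∀ {u v} → Adj u v → Adj v u
    irrefl : ∀ {u} → ¬ Adj u u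
open Graph public

module _ {n : ℕ} (G : Graph n) where

  data Walk : Fin n → Fin n → ℕ → Set where
    nil  : ∀ {u} → Walk u u 0
    cons : ∀ {u w v k} → Adj G u w → Walk w v k → Walk u v (suc k)

  DistLe : Fin n → Fin n → ℕ → Set
  DistLe u v k = ∃[ m ] (m ≤ k × Walk u v m)

  Connected : Set
  Connected = ∀ u v → ∃[ k ] Walk u v k

  EccLe : Fin n → ℕ → Set
  EccLe u k = ∀ v → DistLe u v k

  Leaf : Fin n → Set
  Leaf p = ∃[ w ] (Adj G p w × (∀ w' → Adj G p w' → w' ≡ w))

  ClosedNbr : Fin n → Fin n → Set
  ClosedNbr u w = w ≡ u ⊎ Adj G u w

  TrueTwins : Fin n → Fin n → Set
  TrueTwins u v = ∀ w → ClosedNbr u w ⇔ ClosedNbr v w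

  TrueTwinsIn : (Fin n → Set) → Fin n → Fin n → Set
  TrueTwinsIn W u v = ∀ w → W w → ClosedNbr u w ⇔ ClosedNbr v w

  img : {V₁ V₂ : Subset n} → (Σ (Fin n) (_∈ V₁)) ⤖ (Σ (Fin n) (_∈ V₂))
      → Σ (Fin n) (_∈ V₁) → Fin n
  img φ x = proj₁ (Bijection.to φ x)

  -- F-twins: induced subgraphs on V₁, V₂ of the (induced) graph on vertex set W
  -- (neighbourhoods taken within W), via an isomorphism φ which satisfies
  -- Pres u (φ u) (used for class preservation in partitioned graphs).
  record FTwins (W : Fin n → Set) (Pres : Fin n → Fin n → Set)
                (V₁ V₂ : Subset n) : Set where
    field
      iso     : (Σ (Fin n) (_∈ V₁)) ⤖ (Σ (Fin n) (_∈ V₂))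
      adj-iff : ∀ x y → Adj G (proj₁ x) (proj₁ y) ⇔ Adj G (img iso x) (img iso y)
      pres    : ∀ x → Pres (proj₁ x) (img iso x)
      nbhd    : ∀ x w → W w →
                (Adj G (proj₁ x) w × w ∉ V₁) ⇔ (Adj G (img iso x) w × w ∉ V₂)

data Class : Set where
  core semi peri : Class

AllV : {n : ℕ} → Fin n → Set
AllV _ = ⊤

module _ {n : ℕ} (G : Graph n) (cls : Fin n → Class) where

  InCls : Class → Fin n → Set
  InCls c v = cls v ≡ c

  SP : Fin n → Set
  SP v = cls v ≡ semi ⊎ cls v ≡ peri

  record IsCSP : Set where
    field
      connected     : Connected G
      core-nonempty : ∃[ v ] cls v ≡ core
      semi-nonempty : ∃[ v ] cls v ≡ semi
      peri-nonempty : ∃[ v ] cls v ≡ peri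
      core-ecc      : ∀ u → cls u ≡ core → EccLe G u 2
      semi-cond     : ∀ s → cls s ≡ semi →
                      ∃[ c ] ∃[ p ] (cls c ≡ core × cls p ≡ peri ×
                                     Adj G s c × Adj G s p × ¬ Adj G c p)
      peri-leaf     : ∀ p → cls p ≡ peri → Leaf G p
      no-core-twins : ∀ u v → cls u ≡ core → cls v ≡ core → u ≢ v →
                      ¬ TrueTwins G u v
      no-FTwins     : ∀ (V₁ V₂ : Subset n) →
                      (∀ v → v ∈ V₁ → SP v) → (∀ v → v ∈ V₂ → SP v) →
                      V₁ ≢ V₂ →
                      ¬ FTwins G AllV (λ u v → cls u ≡ cls v) V₁ V₂

  isClass : Class → Class → Bool
  isClass core core = true
  isClass semi semi = true
  isClass peri peri = true
  isClass _ _ = false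

  clsSet : Class → Subset n
  clsSet c = tabulate (λ v → isClass (cls v) c)

-- Every core vertex has eccentricity at most 2, so it equals or is adjacent to the neighbour of every
-- leaf.  Hence the periphery is independent, each core vertex is adjacent to every semiperiphery vertex
-- and to every other vertex carrying a leaf; C₀ is the set of core vertices carrying a leaf and C₁ the
-- remaining ones, which are adjacent to exactly the non-periphery vertices outside C₁, so true twins in
-- C₁ are true twins in the whole graph.  Two leaves on one vertex would be F-twins, so leaves are
-- attached one-to-one to C₀ ∪ S, which gives n_p = n₀ + n_s.  Finally, F-twins within S extend to
-- F-twins within S ∪ P by carrying each pendant leaf along with the vertex it hangs from.

module Submission where

open import Defs hiding (sym)
open import Data.Bool using (Bool; true) renaming (_≟_ to _≟ᵇ_)
open import Data.Bool.Properties using (T-≡)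
open import Data.Fin using (Fin; zero; suc)
open import Data.Fin.Properties using (any?) renaming (_≟_ to _≟ᶠ_)
open import Data.Fin.Subset using (Subset; _∈_; _∉_; ∣_∣; _∪_; _─_; _-_; ⁅_⁆; inside; outside; Nonempty)
open import Data.Fin.Subset.Properties
  using ( _∈?_; nonempty?; Empty-unique; ⊆-antisym; x∈p∪q⁺; x∈p∪q⁻; x∈⁅x⁆; x∈⁅y⁆⇒x≡y
        ; ∣⊥∣≡0; p─⊥≡p; p─q⊆p; x∈p∧x≢y⇒x∈p-y; x∈p⇒∣p-x∣<∣p∣ )
open import Data.Nat using (ℕ; zero; suc; pred; _+_; _≤_; _>_; z≤n; s≤s)
open import Data.Nat.Properties using (≤-antisym; ≤-trans; m≤m+n; m≤n+m; +-suc; module ≤-Reasoning)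
open import Data.Product using (Σ; ∃-syntax; _×_; _,_; proj₁; proj₂)
open import Data.Sum using (_⊎_; inj₁; inj₂; [_,_]; map₂)
open import Data.Unit using (⊤)
open import Data.Vec using (_∷_; []; here; there; tabulate)
open import Data.Vec.Properties using (lookup∘tabulate; []=⇒lookup; lookup⇒[]=)
open import Data.Vec.Properties.WithK using ([]=-irrelevant)
open import Function using (_∘_)
open import Function.Bundles using (_⇔_; mk⇔; _⤖_; _↔_; Equivalence; Inverse; mk↔ₛ′)
open import Function.Properties.Bijection using (⤖⇒↔)
open import Function.Properties.Inverse using (↔⇒⤖; ↔-sym)
open import Function.Construct.Composition using (_⇔-∘_)
open import Function.Construct.Symmetry using (⇔-sym)
open import Level using (Level)
open import Relation.Nullary using (¬_; Dec; yes; no; ⌊_⌋; contradiction)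
open import Relation.Nullary.Decidable
  using (toWitness; fromWitness; _×-dec_; _⊎-dec_; ¬?) renaming (map to Dec-map)
open import Relation.Unary using (Pred; Decidable)
open import Relation.Binary.PropositionalEquality
  using (_≡_; _≢_; refl; sym; trans; cong; subst; subst₂; module ≡-Reasoning)

private
  variable
    ℓ : Level
    n : ℕ
    x y : Fin n
    p q : Subset n

∈-tabulate : (f : Fin n → Bool) → x ∈ tabulate f ⇔ f x ≡ true
∈-tabulate {x = x} f = mk⇔ (λ m → trans (sym (lookup∘tabulate f x)) ([]=⇒lookup m))
                           (λ e → lookup⇒[]= x _ (trans (lookup∘tabulate f x) e))

subset : {P : Pred (Fin n) ℓ} → Decidable P → Subset n
subset P? = tabulate (⌊_⌋ ∘ P?)

module _ {P : Pred (Fin n) ℓ} (P? : Decidable P) where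

  ∈-subset⁻ : x ∈ subset P? → P x
  ∈-subset⁻ {x} m = toWitness {a? = P? x} (Equivalence.from T-≡ (Equivalence.to (∈-tabulate _) m))

  ∈-subset⁺ : P x → x ∈ subset P?
  ∈-subset⁺ {x} px = Equivalence.from (∈-tabulate _) (Equivalence.to T-≡ (fromWitness {a? = P? x} px))

witnessOr : {P : Pred (Fin n) ℓ} → Decidable P → Fin n → Fin n
witnessOr P? default with any? P?
... | yes (x , _) = x
... | no  _       = default

witnessOr-satisfies : {P : Pred (Fin n) ℓ} (P? : Decidable P) {default : Fin n} →
                      ∃[ x ] P x → P (witnessOr P? default)
witnessOr-satisfies P? ∃P with any? P?
... | yes (_ , Px) = Px
... | no  ∄P       = contradiction ∃P ∄P

Σ∈-≡ : x ≡ y → (x∈p : x ∈ p) (y∈p : y ∈ p) → _≡_ {A = Σ (Fin n) (_∈ p)} (x , x∈p) (y , y∈p)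
Σ∈-≡ refl x∈p y∈p = cong (_ ,_) ([]=-irrelevant x∈p y∈p)

∣p∣≡1+∣p-x∣ : x ∈ p → ∣ p ∣ ≡ suc ∣ p - x ∣
∣p∣≡1+∣p-x∣ {x = zero}  {p = inside  ∷ p} here      = cong (suc ∘ ∣_∣) (sym (p─⊥≡p p))
∣p∣≡1+∣p-x∣ {x = suc x} {p = inside  ∷ p} (there m) = cong suc (∣p∣≡1+∣p-x∣ m)
∣p∣≡1+∣p-x∣ {x = suc x} {p = outside ∷ p} (there m) = ∣p∣≡1+∣p-x∣ m

x∈p─q⇒x∉q : ∀ (p q : Subset n) → x ∈ p ─ q → x ∉ q
x∈p─q⇒x∉q (inside ∷ p) (outside ∷ q) here      ()
x∈p─q⇒x∉q (_      ∷ p) (_       ∷ q) (there m) (there m') = x∈p─q⇒x∉q p q m m'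

x∈p-y⇒x≢y : x ∈ p - y → x ≢ y
x∈p-y⇒x≢y {p = p} {y = y} m refl = x∈p─q⇒x∉q p ⁅ y ⁆ m (x∈⁅x⁆ y)

∣p∪q∣≡∣p∣+∣q∣ : ∀ (p q : Subset n) → (∀ {x} → x ∈ p → x ∉ q) → ∣ p ∪ q ∣ ≡ ∣ p ∣ + ∣ q ∣
∣p∪q∣≡∣p∣+∣q∣ []            []            _ = refl
∣p∪q∣≡∣p∣+∣q∣ (inside  ∷ p) (inside  ∷ q) disj = contradiction here (disj here)
∣p∪q∣≡∣p∣+∣q∣ (inside  ∷ p) (outside ∷ q) disj = cong suc (∣p∪q∣≡∣p∣+∣q∣ p q (λ m → disj (there m) ∘ there))
∣p∪q∣≡∣p∣+∣q∣ (outside ∷ p) (inside  ∷ q) disj =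
  trans (cong suc (∣p∪q∣≡∣p∣+∣q∣ p q (λ m → disj (there m) ∘ there))) (sym (+-suc ∣ p ∣ ∣ q ∣))
∣p∪q∣≡∣p∣+∣q∣ (outside ∷ p) (outside ∷ q) disj = ∣p∪q∣≡∣p∣+∣q∣ p q (λ m → disj (there m) ∘ there)

Empty⇒∣p∣≡0 : {p : Subset n} → ¬ Nonempty p → ∣ p ∣ ≡ 0
Empty⇒∣p∣≡0 {n} p-empty = trans (cong ∣_∣ (Empty-unique p-empty)) (∣⊥∣≡0 n)

∣p∣>0 : x ∈ p → ∣ p ∣ > 0
∣p∣>0 m = ≤-trans (s≤s z≤n) (x∈p⇒∣p-x∣<∣p∣ m)

MapsTo : (Fin n → Fin n) → Subset n → Subset n → Set
MapsTo f p q = ∀ {x} → x ∈ p → f x ∈ q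

InjectiveOn : (Fin n → Fin n) → Subset n → Set
InjectiveOn f p = ∀ {x y} → x ∈ p → y ∈ p → f x ≡ f y → x ≡ y

injectiveOn⇒∣p∣≤∣q∣ : (f : Fin n → Fin n) → MapsTo f p q → InjectiveOn f p → ∣ p ∣ ≤ ∣ q ∣
injectiveOn⇒∣p∣≤∣q∣ {p = p} {q = q} f = go ∣ p ∣ p q refl
  where
  go : ∀ k p q → ∣ p ∣ ≡ k → MapsTo f p q → InjectiveOn f p → ∣ p ∣ ≤ ∣ q ∣
  go k p q ∣p∣≡k f∈ inj with nonempty? p
  ... | no p-empty = subst (_≤ ∣ q ∣) (sym (Empty⇒∣p∣≡0 p-empty)) z≤n
  go zero    p q ∣p∣≡0 f∈ inj | yes (x , x∈p) = contradiction (trans (sym (∣p∣≡1+∣p-x∣ x∈p)) ∣p∣≡0) λ ()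
  go (suc k) p q ∣p∣≡k f∈ inj | yes (x , x∈p) = begin
    ∣ p ∣             ≡⟨ ∣p∣≡1+∣p-x∣ x∈p ⟩
    suc ∣ p - x ∣     ≤⟨ s≤s (go k (p - x) (q - f x) ∣p-x∣≡k f∈′ inj′) ⟩
    suc ∣ q - f x ∣   ≡⟨ sym (∣p∣≡1+∣p-x∣ (f∈ x∈p)) ⟩
    ∣ q ∣             ∎
    where
    open ≤-Reasoning
    ∣p-x∣≡k : ∣ p - x ∣ ≡ k
    ∣p-x∣≡k = cong pred (trans (sym (∣p∣≡1+∣p-x∣ x∈p)) ∣p∣≡k)
    f∈′ : MapsTo f (p - x) (q - f x)
    f∈′ {y} m = x∈p∧x≢y⇒x∈p-y (f∈ (p─q⊆p p ⁅ x ⁆ m)) (x∈p-y⇒x≢y m ∘ inj (p─q⊆p p ⁅ x ⁆ m) x∈p)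
    inj′ : InjectiveOn f (p - x)
    inj′ mx my = inj (p─q⊆p p ⁅ x ⁆ mx) (p─q⊆p p ⁅ x ⁆ my)

record SubsetInverse (p q : Subset n) : Set where
  field
    to      : Fin n → Fin n
    from    : Fin n → Fin n
    to∈     : MapsTo to p q
    from∈   : MapsTo from q p
    from∘to : ∀ {x} → x ∈ p → from (to x) ≡ x
    to∘from : ∀ {y} → y ∈ q → to (from y) ≡ y

  to-injectiveOn : InjectiveOn to p
  to-injectiveOn x∈p y∈p e = trans (sym (from∘to x∈p)) (trans (cong from e) (from∘to y∈p))

SubsetInverse-sym : SubsetInverse p q → SubsetInverse q p
SubsetInverse-sym φ = record
  { to = from ; from = to ; to∈ = from∈ ; from∈ = to∈ ; from∘to = to∘from ; to∘from = from∘to }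
  where open SubsetInverse φ

SubsetInverse⇒∣p∣≡∣q∣ : SubsetInverse p q → ∣ p ∣ ≡ ∣ q ∣
SubsetInverse⇒∣p∣≡∣q∣ φ = ≤-antisym (injectiveOn⇒∣p∣≤∣q∣ to to∈ to-injectiveOn)
                                     (injectiveOn⇒∣p∣≤∣q∣ from from∈ from-injectiveOn)
  where
  open SubsetInverse φ
  open SubsetInverse (SubsetInverse-sym φ) using () renaming (to-injectiveOn to from-injectiveOn)

SubsetInverse⇒⤖ : SubsetInverse p q → Σ (Fin n) (_∈ p) ⤖ Σ (Fin n) (_∈ q)
SubsetInverse⇒⤖ φ = ↔⇒⤖ (mk↔ₛ′ (λ (x , m) → to x , to∈ m) (λ (y , m) → from y , from∈ m)
                                (λ (y , m) → Σ∈-≡ (to∘from m) _ _) (λ (x , m) → Σ∈-≡ (from∘to m) _ _))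
  where open SubsetInverse φ

totalise : (p : Subset n) → (Σ (Fin n) (_∈ p) → Fin n) → Fin n → Fin n
totalise p h x with x ∈? p
... | yes x∈p = h (x , x∈p)
... | no  _   = x

totalise-≡ : ∀ p (h : Σ (Fin n) (_∈ p) → Fin n) (x∈p : x ∈ p) → totalise p h x ≡ h (x , x∈p)
totalise-≡ {x = x} p h x∈p with x ∈? p
... | yes x∈p′ = cong h (Σ∈-≡ refl x∈p′ x∈p)
... | no  x∉p  = contradiction x∈p x∉p

module _ (I : Σ (Fin n) (_∈ p) ↔ Σ (Fin n) (_∈ q)) where
  open Inverse I

  totalise-∈ : x ∈ p → totalise p (proj₁ ∘ to) x ∈ q
  totalise-∈ {x} x∈p = subst (_∈ q) (sym (totalise-≡ p _ x∈p)) (proj₂ (to (x , x∈p)))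

  totalise-inverse : x ∈ p → totalise q (proj₁ ∘ from) (totalise p (proj₁ ∘ to) x) ≡ x
  totalise-inverse {x} x∈p = begin
    totalise q (proj₁ ∘ from) (totalise p (proj₁ ∘ to) x)
      ≡⟨ totalise-≡ q _ (totalise-∈ x∈p) ⟩
    proj₁ (from (totalise p (proj₁ ∘ to) x , _))
      ≡⟨ cong (proj₁ ∘ from) (Σ∈-≡ (totalise-≡ p _ x∈p) _ _) ⟩
    proj₁ (from (to (x , x∈p)))
      ≡⟨ cong proj₁ (strictlyInverseʳ (x , x∈p)) ⟩
    x ∎
    where open ≡-Reasoning

↔⇒SubsetInverse : Σ (Fin n) (_∈ p) ↔ Σ (Fin n) (_∈ q) → SubsetInverse p q
↔⇒SubsetInverse {p = p} {q = q} I = record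
  { to      = totalise p (proj₁ ∘ Inverse.to I)
  ; from    = totalise q (proj₁ ∘ Inverse.from I)
  ; to∈     = totalise-∈ I
  ; from∈   = totalise-∈ (↔-sym I)
  ; from∘to = totalise-inverse I
  ; to∘from = totalise-inverse (↔-sym I)
  }

module _ {n : ℕ} (G : Graph n) (W : Fin n → Set) where

  record TwinMap (p q : Subset n) (h : Fin n → Fin n) : Set where
    field
      adj  : ∀ {x y} → x ∈ p → y ∈ p → Adj G x y → Adj G (h x) (h y)
      nbhd : ∀ {x w} → x ∈ p → W w → Adj G x w → w ∉ p → Adj G (h x) w × w ∉ q

  record FTwinMaps (p q : Subset n) : Set where
    field
      inverse   : SubsetInverse p q
    open SubsetInverse inverse public
    field
      to-twin   : TwinMap p q to
      from-twin : TwinMap q p from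

  FTwinMaps⇒FTwins : ∀ {p q} {Pres : Fin n → Fin n → Set} (φ : FTwinMaps p q) →
                     (∀ {x} → x ∈ p → Pres x (FTwinMaps.to φ x)) → FTwins G W Pres p q
  FTwinMaps⇒FTwins φ pres = record
    { iso     = SubsetInverse⇒⤖ inverse
    ; adj-iff = λ (x , x∈p) (y , y∈p) → mk⇔ (TwinMap.adj to-twin x∈p y∈p)
        (subst₂ (Adj G) (from∘to x∈p) (from∘to y∈p) ∘ TwinMap.adj from-twin (to∈ x∈p) (to∈ y∈p))
    ; pres    = λ (x , x∈p) → pres x∈p
    ; nbhd    = λ (x , x∈p) w Ww → mk⇔ (λ (xw , w∉p) → TwinMap.nbhd to-twin x∈p Ww xw w∉p)
        (λ (xw , w∉q) → let (yw , w∉p) = TwinMap.nbhd from-twin (to∈ x∈p) Ww xw w∉q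
                        in subst (λ t → Adj G t w) (from∘to x∈p) yw , w∉p)
    }
    where open FTwinMaps φ

  FTwins⇒FTwinMaps : ∀ {p q} {Pres : Fin n → Fin n → Set} → FTwins G W Pres p q → FTwinMaps p q
  FTwins⇒FTwinMaps {p} {q} ft = record
    { inverse   = φ
    ; to-twin   = record
      { adj  = λ x∈p y∈p → subst₂ (Adj G) (img≡to x∈p) (img≡to y∈p)
                           ∘ Equivalence.to (adj-iff (_ , x∈p) (_ , y∈p))
      ; nbhd = λ x∈p Ww xw w∉p → let (yw , w∉q) = Equivalence.to (nbhd (_ , x∈p) _ Ww) (xw , w∉p)
                                in subst (λ t → Adj G t _) (img≡to x∈p) yw , w∉q
      }
    ; from-twin = record
      { adj  = λ x∈q y∈q → Equivalence.from (adj-iff (_ , from∈ x∈q) (_ , from∈ y∈q))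
                           ∘ subst₂ (Adj G) (sym (img∘from x∈q)) (sym (img∘from y∈q))
      ; nbhd = λ x∈q Ww xw w∉q → Equivalence.from (nbhd (_ , from∈ x∈q) _ Ww)
                                   (subst (λ t → Adj G t _) (sym (img∘from x∈q)) xw , w∉q)
      }
    }
    where
    open FTwins ft
    φ : SubsetInverse p q
    φ = ↔⇒SubsetInverse (⤖⇒↔ iso)
    open SubsetInverse φ
    img≡to : ∀ {x} (x∈p : x ∈ p) → img G iso (x , x∈p) ≡ to x
    img≡to x∈p = sym (totalise-≡ p _ x∈p)
    img∘from : ∀ {y} (y∈q : y ∈ q) → img G iso (from y , from∈ y∈q) ≡ y
    img∘from y∈q = trans (img≡to (from∈ y∈q)) (to∘from y∈q)

module CSP {n : ℕ} {G : Graph n} {cls : Fin n → Class} (H : IsCSP G cls) where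
  open IsCSP H

  private
    adj-sym : ∀ {u v} → Adj G u v → Adj G v u
    adj-sym = Graph.sym G

  isClass⇔≡ : ∀ a b → isClass G cls a b ≡ true ⇔ a ≡ b
  isClass⇔≡ core core = mk⇔ (λ _ → refl) (λ _ → refl)
  isClass⇔≡ semi semi = mk⇔ (λ _ → refl) (λ _ → refl)
  isClass⇔≡ peri peri = mk⇔ (λ _ → refl) (λ _ → refl)
  isClass⇔≡ core semi = mk⇔ (λ ()) (λ ())
  isClass⇔≡ core peri = mk⇔ (λ ()) (λ ())
  isClass⇔≡ semi core = mk⇔ (λ ()) (λ ())
  isClass⇔≡ semi peri = mk⇔ (λ ()) (λ ())
  isClass⇔≡ peri core = mk⇔ (λ ()) (λ ())
  isClass⇔≡ peri semi = mk⇔ (λ ()) (λ ())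

  _≟ᶜ_ : (a b : Class) → Dec (a ≡ b)
  a ≟ᶜ b = Dec-map (isClass⇔≡ a b) (isClass G cls a b ≟ᵇ true)

  ∈-clsSet : ∀ {c v} → v ∈ clsSet G cls c ⇔ cls v ≡ c
  ∈-clsSet = isClass⇔≡ _ _ ⇔-∘ ∈-tabulate _

  class-unique : ∀ {v a b} → cls v ≡ a → cls v ≡ b → a ≡ b
  class-unique va vb = trans (sym va) vb

  leaf-unique : ∀ {p a b} → cls p ≡ peri → Adj G p a → Adj G p b → a ≡ b
  leaf-unique {p} p∈P pa pb =
    let (_ , _ , unique) = peri-leaf p p∈P in trans (unique _ pa) (sym (unique _ pb))

  -- A core vertex reaches each leaf within two steps, necessarily through the leaf's only neighbour.
  closedNbr-core-periNbr : ∀ {u p w} → cls u ≡ core → cls p ≡ peri → Adj G p w → ClosedNbr G u w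
  closedNbr-core-periNbr {u} {p} u∈C p∈P pw with core-ecc u u∈C p
  ... | _ , _ , nil = contradiction (class-unique u∈C p∈P) λ ()
  ... | _ , _ , cons up nil = inj₁ (leaf-unique p∈P pw (adj-sym up))
  ... | _ , _ , cons ua (cons ap nil) = inj₂ (subst (Adj G u) (leaf-unique p∈P (adj-sym ap) pw) ua)
  ... | _ , s≤s (s≤s ()) , cons _ (cons _ (cons _ _))

  peri-nonadj : ∀ {p q} → cls p ≡ peri → cls q ≡ peri → ¬ Adj G p q
  peri-nonadj {p} {q} p∈P q∈P pq with core-nonempty
  ... | u , u∈C with closedNbr-core-periNbr u∈C p∈P pq
  ... | inj₁ refl = contradiction (class-unique u∈C q∈P) λ ()
  ... | inj₂ uq   = contradiction (class-unique u∈C u∈P) λ ()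
    where
    u∈P : cls u ≡ peri
    u∈P = subst (λ t → cls t ≡ peri) (leaf-unique q∈P (adj-sym pq) (adj-sym uq)) p∈P

  core-semi-adj : ∀ {u s} → cls u ≡ core → cls s ≡ semi → Adj G u s
  core-semi-adj {u} {s} u∈C s∈S with semi-cond s s∈S
  ... | _ , p , _ , p∈P , _ , sp , _ with closedNbr-core-periNbr u∈C p∈P (adj-sym sp)
  ... | inj₁ refl = contradiction (class-unique u∈C s∈S) λ ()
  ... | inj₂ us   = us

  HasPeriNbr : Fin n → Set
  HasPeriNbr u = ∃[ q ] (Adj G u q × cls q ≡ peri)

  periNbr? : ∀ u q → Dec (Adj G u q × cls q ≡ peri)
  periNbr? u q = adj? G u q ×-dec (cls q ≟ᶜ peri)

  semi-hasPeriNbr : ∀ {s} → cls s ≡ semi → HasPeriNbr s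
  semi-hasPeriNbr {s} s∈S = let (_ , p , _ , p∈P , _ , sp , _) = semi-cond s s∈S in p , sp , p∈P

  core-adj-hasPeriNbr : ∀ {v u} → cls v ≡ core → HasPeriNbr u → v ≢ u → Adj G v u
  core-adj-hasPeriNbr v∈C (q , uq , q∈P) v≢u with closedNbr-core-periNbr v∈C q∈P (adj-sym uq)
  ... | inj₁ u≡v = contradiction (sym u≡v) v≢u
  ... | inj₂ vu  = vu

  sharedNbr-leaf-TwinMap : ∀ {w a b} → Adj G w a → cls a ≡ peri → Adj G w b →
                           TwinMap G AllV ⁅ a ⁆ ⁅ b ⁆ (λ _ → b)
  sharedNbr-leaf-TwinMap {w} {a} {b} wa a∈P wb = record
    { adj  = λ x∈⁅a⁆ y∈⁅a⁆ xy →
        contradiction (subst₂ (Adj G) (x∈⁅y⁆⇒x≡y a x∈⁅a⁆) (x∈⁅y⁆⇒x≡y a y∈⁅a⁆) xy) (irrefl G)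
    ; nbhd = λ {x} {z} x∈⁅a⁆ _ xz _ →
        let z≡w = leaf-unique a∈P (subst (λ t → Adj G t z) (x∈⁅y⁆⇒x≡y a x∈⁅a⁆) xz) (adj-sym wa)
        in  subst (Adj G b) (sym z≡w) (adj-sym wb)
          , λ z∈⁅b⁆ → irrefl G (subst (Adj G w) (trans (sym (x∈⁅y⁆⇒x≡y b z∈⁅b⁆)) z≡w) wb)
    }

  sharedNbr-leaves-FTwins : ∀ {w p p′} → Adj G w p → cls p ≡ peri → Adj G w p′ → cls p′ ≡ peri →
                            FTwins G AllV (λ u v → cls u ≡ cls v) ⁅ p ⁆ ⁅ p′ ⁆
  sharedNbr-leaves-FTwins {w} {p} {p′} wp p∈P wp′ p′∈P = FTwinMaps⇒FTwins G AllV swap pres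
    where
    swap : FTwinMaps G AllV ⁅ p ⁆ ⁅ p′ ⁆
    swap = record
      { inverse   = record
        { to = λ _ → p′ ; from = λ _ → p ; to∈ = λ _ → x∈⁅x⁆ p′ ; from∈ = λ _ → x∈⁅x⁆ p
        ; from∘to = sym ∘ x∈⁅y⁆⇒x≡y p ; to∘from = sym ∘ x∈⁅y⁆⇒x≡y p′ }
      ; to-twin   = sharedNbr-leaf-TwinMap wp p∈P wp′
      ; from-twin = sharedNbr-leaf-TwinMap wp′ p′∈P wp
      }
    pres : ∀ {x} → x ∈ ⁅ p ⁆ → cls x ≡ cls p′
    pres x∈⁅p⁆ = trans (subst (λ t → cls t ≡ peri) (sym (x∈⁅y⁆⇒x≡y p x∈⁅p⁆)) p∈P) (sym p′∈P)

  periNbr-unique : ∀ {w p p′} → Adj G w p → cls p ≡ peri → Adj G w p′ → cls p′ ≡ peri → p ≡ p′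
  periNbr-unique {w} {p} {p′} wp p∈P wp′ p′∈P with p ≟ᶠ p′
  ... | yes p≡p′ = p≡p′
  ... | no  p≢p′ = contradiction (sharedNbr-leaves-FTwins wp p∈P wp′ p′∈P)
                                 (no-FTwins ⁅ p ⁆ ⁅ p′ ⁆ (⁅⁆-SP p∈P) (⁅⁆-SP p′∈P) (p≢p′ ∘ ⁅⁆-injective))
    where
    ⁅⁆-injective : ⁅ p ⁆ ≡ ⁅ p′ ⁆ → p ≡ p′
    ⁅⁆-injective e = x∈⁅y⁆⇒x≡y p′ (subst (p ∈_) e (x∈⁅x⁆ p))
    ⁅⁆-SP : ∀ {a} → cls a ≡ peri → ∀ v → v ∈ ⁅ a ⁆ → SP G cls v
    ⁅⁆-SP {a} a∈P v v∈⁅a⁆ = inj₂ (subst (λ t → cls t ≡ peri) (sym (x∈⁅y⁆⇒x≡y a v∈⁅a⁆)) a∈P)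

  attach : Fin n → Fin n
  attach p = witnessOr (adj? G p) p

  attach-adj : ∀ {p} → cls p ≡ peri → Adj G p (attach p)
  attach-adj {p} p∈P = witnessOr-satisfies (adj? G p) (let (w , pw , _) = peri-leaf p p∈P in w , pw)

  pendant : Fin n → Fin n
  pendant w = witnessOr (periNbr? w) w

  pendant-periNbr : ∀ {w} → HasPeriNbr w → Adj G w (pendant w) × cls (pendant w) ≡ peri
  pendant-periNbr {w} = witnessOr-satisfies (periNbr? w)

  attach∘pendant : ∀ {w} → HasPeriNbr w → attach (pendant w) ≡ w
  attach∘pendant hasP = let (wp , p∈P) = pendant-periNbr hasP in leaf-unique p∈P (attach-adj p∈P) (adj-sym wp)

  pendant∘attach : ∀ {p} → cls p ≡ peri → pendant (attach p) ≡ p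
  pendant∘attach p∈P =
    let pa = attach-adj p∈P ; (ap′ , p′∈P) = pendant-periNbr (_ , adj-sym pa , p∈P)
    in periNbr-unique ap′ p′∈P (adj-sym pa) p∈P

  hasPeriNbr? : ∀ u → Dec (HasPeriNbr u)
  hasPeriNbr? u = any? (periNbr? u)

  C₀ C₁ : Subset n
  C₀ = subset (λ u → (cls u ≟ᶜ core) ×-dec hasPeriNbr? u)
  C₁ = subset (λ u → (cls u ≟ᶜ core) ×-dec ¬? (hasPeriNbr? u))

  ∈C₀⁻ : ∀ {u} → u ∈ C₀ → cls u ≡ core × HasPeriNbr u
  ∈C₀⁻ = ∈-subset⁻ _

  ∈C₁⁻ : ∀ {u} → u ∈ C₁ → cls u ≡ core × ¬ HasPeriNbr u
  ∈C₁⁻ = ∈-subset⁻ _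

  core⇔C₀⊎C₁ : ∀ {v} → cls v ≡ core ⇔ (v ∈ C₀ ⊎ v ∈ C₁)
  core⇔C₀⊎C₁ {v} = mk⇔ split [ proj₁ ∘ ∈C₀⁻ , proj₁ ∘ ∈C₁⁻ ]
    where
    split : cls v ≡ core → v ∈ C₀ ⊎ v ∈ C₁
    split v∈C with hasPeriNbr? v
    ... | yes hasP = inj₁ (∈-subset⁺ _ (v∈C , hasP))
    ... | no  noP  = inj₂ (∈-subset⁺ _ (v∈C , noP))

  C₀-C₁-disjoint : ∀ {v} → v ∈ C₀ → v ∉ C₁
  C₀-C₁-disjoint v∈C₀ v∈C₁ = proj₂ (∈C₁⁻ v∈C₁) (proj₂ (∈C₀⁻ v∈C₀))

  C₀-adj-core : ∀ {u v} → u ∈ C₀ → cls v ≡ core → u ≢ v → Adj G u v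
  C₀-adj-core u∈C₀ v∈C u≢v = adj-sym (core-adj-hasPeriNbr v∈C (proj₂ (∈C₀⁻ u∈C₀)) (u≢v ∘ sym))

  ∣C₀∣+∣C₁∣>0 : ∣ C₀ ∣ + ∣ C₁ ∣ > 0
  ∣C₀∣+∣C₁∣>0 with Equivalence.to core⇔C₀⊎C₁ (proj₂ core-nonempty)
  ... | inj₁ v∈C₀ = ≤-trans (∣p∣>0 v∈C₀) (m≤m+n ∣ C₀ ∣ ∣ C₁ ∣)
  ... | inj₂ v∈C₁ = ≤-trans (∣p∣>0 v∈C₁) (m≤n+m ∣ C₁ ∣ ∣ C₀ ∣)

  C₁-closedNbr-outside : ∀ {u w} → u ∈ C₁ → w ∉ C₁ → ClosedNbr G u w ⇔ (cls w ≢ peri)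
  C₁-closedNbr-outside {u} {w} u∈C₁ w∉C₁ = mk⇔ to from
    where
    to : ClosedNbr G u w → cls w ≢ peri
    to (inj₁ refl) _    = w∉C₁ u∈C₁
    to (inj₂ uw)   w∈P = proj₂ (∈C₁⁻ u∈C₁) (w , uw , w∈P)
    from : cls w ≢ peri → ClosedNbr G u w
    from w∉P with cls w in w∈cls | hasPeriNbr? w
    ... | core | yes hasP = inj₂ (core-adj-hasPeriNbr (proj₁ (∈C₁⁻ u∈C₁)) hasP λ { refl → w∉C₁ u∈C₁ })
    ... | core | no  noP  = contradiction (∈-subset⁺ _ (w∈cls , noP)) w∉C₁
    ... | semi | _        = inj₂ (core-semi-adj (proj₁ (∈C₁⁻ u∈C₁)) w∈cls)
    ... | peri | _        = contradiction refl w∉P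

  C₁-noTrueTwins : ∀ {u v} → u ∈ C₁ → v ∈ C₁ → u ≢ v → ¬ TrueTwinsIn G (_∈ C₁) u v
  C₁-noTrueTwins {u} {v} u∈C₁ v∈C₁ u≢v twinsIn =
    no-core-twins u v (proj₁ (∈C₁⁻ u∈C₁)) (proj₁ (∈C₁⁻ v∈C₁)) u≢v twins
    where
    twins : TrueTwins G u v
    twins w with w ∈? C₁
    ... | yes w∈C₁ = twinsIn w w∈C₁
    ... | no  w∉C₁ = ⇔-sym (C₁-closedNbr-outside v∈C₁ w∉C₁) ⇔-∘ C₁-closedNbr-outside u∈C₁ w∉C₁

  Attachment : Fin n → Set
  Attachment w = w ∈ C₀ ⊎ cls w ≡ semi

  attachment-hasPeriNbr : ∀ {w} → Attachment w → HasPeriNbr w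
  attachment-hasPeriNbr = [ proj₂ ∘ ∈C₀⁻ , semi-hasPeriNbr ]

  periNbr-attachment : ∀ {p w} → cls p ≡ peri → Adj G p w → Attachment w
  periNbr-attachment {p} {w} p∈P pw with cls w in w∈cls
  ... | core = inj₁ (∈-subset⁺ _ (w∈cls , p , adj-sym pw , p∈P))
  ... | semi = inj₂ refl
  ... | peri = contradiction pw (peri-nonadj p∈P w∈cls)

  leaf-attachment : ∀ p → cls p ≡ peri → ∃[ w ] (Adj G p w × Attachment w × (∀ w′ → Adj G p w′ → w′ ≡ w))
  leaf-attachment p p∈P =
    attach p , pa , periNbr-attachment p∈P pa , λ _ pw′ → leaf-unique p∈P pw′ pa
    where pa = attach-adj p∈P

  attachment-leaf : ∀ w → Attachment w →
                    ∃[ p ] (cls p ≡ peri × Adj G w p × (∀ p′ → cls p′ ≡ peri → Adj G w p′ → p′ ≡ p))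
  attachment-leaf w att =
    let (wp , p∈P) = pendant-periNbr (attachment-hasPeriNbr att)
    in pendant w , p∈P , wp , λ _ p′∈P wp′ → periNbr-unique wp′ p′∈P wp p∈P

  attachments : Subset n
  attachments = C₀ ∪ clsSet G cls semi

  ∈attachments : ∀ {w} → w ∈ attachments ⇔ Attachment w
  ∈attachments = mk⇔ (map₂ (Equivalence.to ∈-clsSet) ∘ x∈p∪q⁻ _ _)
                     (x∈p∪q⁺ ∘ map₂ (Equivalence.from ∈-clsSet))

  periphery⇿attachments : SubsetInverse (clsSet G cls peri) attachments
  periphery⇿attachments = record
    { to      = attach
    ; from    = pendant
    ; to∈     = λ p∈P → let p∈P′ = Equivalence.to ∈-clsSet p∈P in
                        Equivalence.from ∈attachments (periNbr-attachment p∈P′ (attach-adj p∈P′))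
    ; from∈   = λ w∈A → Equivalence.from ∈-clsSet
                          (proj₂ (pendant-periNbr (attachment-hasPeriNbr (Equivalence.to ∈attachments w∈A))))
    ; from∘to = pendant∘attach ∘ Equivalence.to ∈-clsSet
    ; to∘from = attach∘pendant ∘ attachment-hasPeriNbr ∘ Equivalence.to ∈attachments
    }

  ∣periphery∣≡∣C₀∣+∣semiperiphery∣ : ∣ clsSet G cls peri ∣ ≡ ∣ C₀ ∣ + ∣ clsSet G cls semi ∣
  ∣periphery∣≡∣C₀∣+∣semiperiphery∣ = trans (SubsetInverse⇒∣p∣≡∣q∣ periphery⇿attachments)
    (∣p∪q∣≡∣p∣+∣q∣ C₀ _ λ v∈C₀ v∈S →
      contradiction (class-unique (proj₁ (∈C₀⁻ v∈C₀)) (Equivalence.to ∈-clsSet v∈S)) λ ())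

  AllSemi : Subset n → Set
  AllSemi V = ∀ v → v ∈ V → cls v ≡ semi

  withLeaves : Subset n → Subset n
  withLeaves V = subset (λ x → (x ∈? V) ⊎-dec ((cls x ≟ᶜ peri) ×-dec (attach x ∈? V)))

  module _ {V : Subset n} where

    ∈withLeaves : ∀ {x} → x ∈ V → x ∈ withLeaves V
    ∈withLeaves = ∈-subset⁺ _ ∘ inj₁

    leaf∈withLeaves : ∀ {x} → cls x ≡ peri → attach x ∈ V → x ∈ withLeaves V
    leaf∈withLeaves x∈P ax∈V = ∈-subset⁺ _ (inj₂ (x∈P , ax∈V))

    withLeaves-leaf : ∀ {x} → x ∈ withLeaves V → x ∉ V → cls x ≡ peri × attach x ∈ V
    withLeaves-leaf x∈V⁺ x∉V = [ (λ x∈V → contradiction x∈V x∉V) , (λ leaf → leaf) ] (∈-subset⁻ _ x∈V⁺)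

    ∉withLeaves : ∀ {x} → x ∉ V → cls x ≢ peri → x ∉ withLeaves V
    ∉withLeaves x∉V x∉P x∈V⁺ = x∉P (proj₁ (withLeaves-leaf x∈V⁺ x∉V))

    withLeaves-SP : AllSemi V → ∀ v → v ∈ withLeaves V → SP G cls v
    withLeaves-SP V⊆S v v∈V⁺ with v ∈? V
    ... | yes v∈V = inj₁ (V⊆S v v∈V)
    ... | no  v∉V = inj₂ (proj₁ (withLeaves-leaf v∈V⁺ v∉V))

    withLeaves-semi : AllSemi V → ∀ {v} → v ∈ withLeaves V → cls v ≡ semi → v ∈ V
    withLeaves-semi V⊆S {v} v∈V⁺ v∈S with v ∈? V
    ... | yes v∈V = v∈V
    ... | no  v∉V = contradiction (class-unique v∈S (proj₁ (withLeaves-leaf v∈V⁺ v∉V))) λ ()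

  withLeaves-injective : ∀ {V₁ V₂} → AllSemi V₁ → AllSemi V₂ → withLeaves V₁ ≡ withLeaves V₂ → V₁ ≡ V₂
  withLeaves-injective {V₁} {V₂} V₁⊆S V₂⊆S e = ⊆-antisym
    (λ {v} v∈V₁ → withLeaves-semi V₂⊆S (subst (v ∈_) e (∈withLeaves v∈V₁)) (V₁⊆S v v∈V₁))
    (λ {v} v∈V₂ → withLeaves-semi V₁⊆S (subst (v ∈_) (sym e) (∈withLeaves v∈V₂)) (V₂⊆S v v∈V₂))

  liftToLeaves : Subset n → (Fin n → Fin n) → Fin n → Fin n
  liftToLeaves V h x with x ∈? V
  ... | yes _ = h x
  ... | no  _ = pendant (h (attach x))

  liftToLeaves-∈ : ∀ {V h x} → x ∈ V → liftToLeaves V h x ≡ h x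
  liftToLeaves-∈ {V} {h} {x} x∈V with x ∈? V
  ... | yes _   = refl
  ... | no  x∉V = contradiction x∈V x∉V

  liftToLeaves-∉ : ∀ {V h x} → x ∉ V → liftToLeaves V h x ≡ pendant (h (attach x))
  liftToLeaves-∉ {V} {h} {x} x∉V with x ∈? V
  ... | yes x∈V = contradiction x∈V x∉V
  ... | no  _   = refl

  module Lift {V₁ V₂ : Subset n} (V₁⊆S : AllSemi V₁) (V₂⊆S : AllSemi V₂) (φ : SubsetInverse V₁ V₂) where
    open SubsetInverse φ

    lift : Fin n → Fin n
    lift = liftToLeaves V₁ to

    private
      to-hasPeriNbr : ∀ {a} → a ∈ V₁ → HasPeriNbr (to a)
      to-hasPeriNbr a∈V₁ = semi-hasPeriNbr (V₂⊆S _ (to∈ a∈V₁))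

      pendant∘to-peri : ∀ {a} → a ∈ V₁ → cls (pendant (to a)) ≡ peri
      pendant∘to-peri = proj₂ ∘ pendant-periNbr ∘ to-hasPeriNbr

      leaf∉V₂ : ∀ {y} → cls y ≡ peri → y ∉ V₂
      leaf∉V₂ y∈P y∈V₂ = contradiction (class-unique (V₂⊆S _ y∈V₂) y∈P) λ ()

      adj-leaf : ∀ {x y} → x ∈ V₁ → y ∈ withLeaves V₁ → y ∉ V₁ → Adj G x y →
                 Adj G (to x) (pendant (to (attach y)))
      adj-leaf {x} {y} x∈V₁ y∈V₁⁺ y∉V₁ xy =
        subst (λ a → Adj G (to x) (pendant (to a))) x≡ay (proj₁ (pendant-periNbr (to-hasPeriNbr x∈V₁)))
        where
        y∈P = proj₁ (withLeaves-leaf y∈V₁⁺ y∉V₁)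
        x≡ay = leaf-unique y∈P (adj-sym xy) (attach-adj y∈P)

    lift∈ : MapsTo lift (withLeaves V₁) (withLeaves V₂)
    lift∈ {x} x∈V₁⁺ with x ∈? V₁
    ... | yes x∈V₁ = ∈withLeaves (to∈ x∈V₁)
    ... | no  x∉V₁ = let ax∈V₁ = proj₂ (withLeaves-leaf x∈V₁⁺ x∉V₁) in
                     leaf∈withLeaves (pendant∘to-peri ax∈V₁)
                                     (subst (_∈ V₂) (sym (attach∘pendant (to-hasPeriNbr ax∈V₁))) (to∈ ax∈V₁))

    lift-inverse : ∀ {x} → x ∈ withLeaves V₁ → liftToLeaves V₂ from (lift x) ≡ x
    lift-inverse {x} x∈V₁⁺ with x ∈? V₁
    ... | yes x∈V₁ = trans (liftToLeaves-∈ (to∈ x∈V₁)) (from∘to x∈V₁)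
    ... | no  x∉V₁ = begin
      liftToLeaves V₂ from (pendant (to a))    ≡⟨ liftToLeaves-∉ (leaf∉V₂ (pendant∘to-peri a∈V₁)) ⟩
      pendant (from (attach (pendant (to a)))) ≡⟨ cong (pendant ∘ from) (attach∘pendant (to-hasPeriNbr a∈V₁)) ⟩
      pendant (from (to a))                    ≡⟨ cong pendant (from∘to a∈V₁) ⟩
      pendant (attach x)                       ≡⟨ pendant∘attach (proj₁ (withLeaves-leaf x∈V₁⁺ x∉V₁)) ⟩
      x                                        ∎
      where
      open ≡-Reasoning
      a = attach x
      a∈V₁ = proj₂ (withLeaves-leaf x∈V₁⁺ x∉V₁)

    lift-pres : ∀ {x} → x ∈ withLeaves V₁ → cls x ≡ cls (lift x)
    lift-pres {x} x∈V₁⁺ with x ∈? V₁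
    ... | yes x∈V₁ = trans (V₁⊆S x x∈V₁) (sym (V₂⊆S _ (to∈ x∈V₁)))
    ... | no  x∉V₁ = let (x∈P , a∈V₁) = withLeaves-leaf x∈V₁⁺ x∉V₁ in trans x∈P (sym (pendant∘to-peri a∈V₁))

    lift-twin : TwinMap G (InCls G cls semi) V₁ V₂ to → TwinMap G AllV (withLeaves V₁) (withLeaves V₂) lift
    lift-twin twin = record { adj = adj ; nbhd = nbhd }
      where
      adj : ∀ {x y} → x ∈ withLeaves V₁ → y ∈ withLeaves V₁ → Adj G x y → Adj G (lift x) (lift y)
      adj {x} {y} x∈V₁⁺ y∈V₁⁺ xy with x ∈? V₁ | y ∈? V₁
      ... | yes x∈V₁ | yes y∈V₁ = TwinMap.adj twin x∈V₁ y∈V₁ xy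
      ... | yes x∈V₁ | no  y∉V₁ = adj-leaf x∈V₁ y∈V₁⁺ y∉V₁ xy
      ... | no  x∉V₁ | yes y∈V₁ = adj-sym (adj-leaf y∈V₁ x∈V₁⁺ x∉V₁ (adj-sym xy))
      ... | no  x∉V₁ | no  y∉V₁ = contradiction xy (peri-nonadj (proj₁ (withLeaves-leaf x∈V₁⁺ x∉V₁))
                                                                (proj₁ (withLeaves-leaf y∈V₁⁺ y∉V₁)))
      nbhd : ∀ {x w} → x ∈ withLeaves V₁ → AllV w → Adj G x w → w ∉ withLeaves V₁ →
             Adj G (lift x) w × w ∉ withLeaves V₂
      nbhd {x} {w} x∈V₁⁺ _ xw w∉V₁⁺ with x ∈? V₁
      ... | no  x∉V₁ = let (x∈P , ax∈V₁) = withLeaves-leaf x∈V₁⁺ x∉V₁ in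
                       contradiction (∈withLeaves (subst (_∈ V₁) (leaf-unique x∈P (attach-adj x∈P) xw) ax∈V₁))
                                     w∉V₁⁺
      ... | yes x∈V₁ with cls w in w∈cls
      ...   | core = adj-sym (core-semi-adj w∈cls (V₂⊆S _ (to∈ x∈V₁)))
                   , ∉withLeaves (λ w∈V₂ → contradiction (class-unique w∈cls (V₂⊆S w w∈V₂)) λ ())
                                 (λ w∈P → contradiction (class-unique w∈cls w∈P) λ ())
      ...   | semi = let (tw , w∉V₂) = TwinMap.nbhd twin x∈V₁ w∈cls xw (w∉V₁⁺ ∘ ∈withLeaves) in
                     tw , ∉withLeaves w∉V₂ (λ w∈P → contradiction (class-unique w∈cls w∈P) λ ())
      ...   | peri = contradiction (leaf∈withLeaves w∈cls (subst (_∈ V₁) x≡aw x∈V₁)) w∉V₁⁺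
        where x≡aw = leaf-unique w∈cls (adj-sym xw) (attach-adj w∈cls)

  liftFTwinMaps : ∀ {V₁ V₂} → AllSemi V₁ → AllSemi V₂ →
                  FTwinMaps G (InCls G cls semi) V₁ V₂ → FTwinMaps G AllV (withLeaves V₁) (withLeaves V₂)
  liftFTwinMaps V₁⊆S V₂⊆S φ = record
    { inverse   = record
      { to = L.lift ; from = L′.lift ; to∈ = L.lift∈ ; from∈ = L′.lift∈
      ; from∘to = L.lift-inverse ; to∘from = L′.lift-inverse }
    ; to-twin   = L.lift-twin to-twin
    ; from-twin = L′.lift-twin from-twin
    }
    where
    open FTwinMaps φ
    module L  = Lift V₁⊆S V₂⊆S inverse
    module L′ = Lift V₂⊆S V₁⊆S (SubsetInverse-sym inverse)

  semi-noFTwins : ∀ V₁ V₂ → AllSemi V₁ → AllSemi V₂ → V₁ ≢ V₂ →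
                  ¬ FTwins G (InCls G cls semi) (λ _ _ → ⊤) V₁ V₂
  semi-noFTwins V₁ V₂ V₁⊆S V₂⊆S V₁≢V₂ ft =
    no-FTwins (withLeaves V₁) (withLeaves V₂) (withLeaves-SP V₁⊆S) (withLeaves-SP V₂⊆S)
              (V₁≢V₂ ∘ withLeaves-injective V₁⊆S V₂⊆S)
              (FTwinMaps⇒FTwins G AllV lifted (Lift.lift-pres V₁⊆S V₂⊆S (FTwinMaps.inverse φ)))
    where
    φ = FTwins⇒FTwinMaps G (InCls G cls semi) ft
    lifted = liftFTwinMaps V₁⊆S V₂⊆S φ

theorem3 : ∀ (n : ℕ) (G : Graph n) (cls : Fin n → Class) → IsCSP G cls →
    ∃[ C₀ ] ∃[ C₁ ]
      ((∀ v → cls v ≡ core ⇔ (v ∈ C₀ ⊎ v ∈ C₁)) ×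
       (∀ v → ¬ (v ∈ C₀ × v ∈ C₁)) ×
       ∣ C₀ ∣ + ∣ C₁ ∣ > 0 ×
       (∀ u v → u ∈ C₀ → v ∈ C₁ → Adj G u v) ×
       (∀ u v → u ∈ C₀ → v ∈ C₀ → u ≢ v → Adj G u v) ×
       (∀ u v → u ∈ C₁ → v ∈ C₁ → u ≢ v → ¬ TrueTwinsIn G (_∈ C₁) u v) ×
       (∀ u v → cls u ≡ core → cls v ≡ semi → Adj G u v) ×
       (∀ (V₁ V₂ : Subset n) →
          (∀ v → v ∈ V₁ → cls v ≡ semi) → (∀ v → v ∈ V₂ → cls v ≡ semi) →
          V₁ ≢ V₂ → ¬ FTwins G (InCls G cls semi) (λ _ _ → ⊤) V₁ V₂) ×
       (∀ u v → cls u ≡ peri → cls v ≡ peri → ¬ Adj G u v) ×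
       ∣ clsSet G cls peri ∣ ≡ ∣ C₀ ∣ + ∣ clsSet G cls semi ∣ ×
       (∀ p → cls p ≡ peri → Leaf G p) ×
       (∀ p → cls p ≡ peri →
          ∃[ w ] (Adj G p w × (w ∈ C₀ ⊎ cls w ≡ semi) ×
                  (∀ w' → Adj G p w' → w' ≡ w))) ×
       (∀ w → (w ∈ C₀ ⊎ cls w ≡ semi) →
          ∃[ p ] (cls p ≡ peri × Adj G w p ×
                  (∀ p' → cls p' ≡ peri → Adj G w p' → p' ≡ p))) ×
       ∣ clsSet G cls core ∣ > 0 × ∣ clsSet G cls semi ∣ > 0 × ∣ clsSet G cls peri ∣ > 0)
theorem3 n G cls H =
  C₀ , C₁ , (λ _ → core⇔C₀⊎C₁) , (λ _ (v∈C₀ , v∈C₁) → C₀-C₁-disjoint v∈C₀ v∈C₁) , ∣C₀∣+∣C₁∣>0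
  , (λ _ _ u∈C₀ v∈C₁ → C₀-adj-core u∈C₀ (proj₁ (∈C₁⁻ v∈C₁)) λ { refl → C₀-C₁-disjoint u∈C₀ v∈C₁ })
  , (λ _ _ u∈C₀ v∈C₀ → C₀-adj-core u∈C₀ (proj₁ (∈C₀⁻ v∈C₀)))
  , (λ _ _ → C₁-noTrueTwins) , (λ _ _ → core-semi-adj) , semi-noFTwins , (λ _ _ → peri-nonadj)
  , ∣periphery∣≡∣C₀∣+∣semiperiphery∣ , peri-leaf , leaf-attachment , attachment-leaf
  , nonempty core-nonempty , nonempty semi-nonempty , nonempty peri-nonempty
  where
  open IsCSP H
  open CSP H
  nonempty : ∀ {c} → ∃[ v ] cls v ≡ c → ∣ clsSet G cls c ∣ > 0
  nonempty (_ , v∈c) = ∣p∣>0 (Equivalence.from ∈-clsSet v∈c)
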